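{- Let $a\in\mathbb{N}$, $a\ge 1$, and let $k$ be an integer with $k\ge 4a-2$. Then every tree $T$ on $ak$ vertices can be decomposed into $2a$ subtrees, each having at most $k$ vertices.
   Context: A decomposition of a tree $T$ into subtrees $T_1,\dots,T_r$ means that each $T_i$ is a subtree of $T$, the edge sets $E(T_1),\dots,E(T_r)$ partition $E(T)$ (some may be empty), and $V(T)=\bigcup_i V(T_i)$. -}

module Defs where

open import Data.Nat using (ℕ; _≤_; _<_)
open import Data.Bool using (Bool; true; false; T)
open import Data.Fin using (Fin)
open import Data.List using (List; []; _∷_; length; filterᵇ; head; last)
open import Data.List.Base using (allFin)
open import Data.List.Relation.Unary.Unique.Propositional using (Unique)
open import Data.List.Relation.Unary.Linked using (Linked)
open import Data.Maybe using (Maybe; just; nothing)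
open import Data.Product using (Σ; ∃; _×_; _,_)
open import Relation.Binary.PropositionalEquality using (_≡_)
open import Relation.Nullary using (¬_)

-- A (simple) graph living inside the vertex set Fin n:
-- a vertex subset V and an adjacency relation E, both Boolean-valued.
VSet : ℕ → Set
VSet n = Fin n → Bool

ESet : ℕ → Set
ESet n = Fin n → Fin n → Bool

full : ∀ {n} → VSet n
full _ = true

size : ∀ {n} → VSet n → ℕ
size {n} V = length (filterᵇ V (allFin n))

IsSimpleGraph : ∀ {n} → VSet n → ESet n → Set
IsSimpleGraph V E =
  (∀ u v → E u v ≡ E v u) ×
  (∀ u → E u u ≡ false) ×
  (∀ u v → E u v ≡ true → V u ≡ true)

-- walks in (V , E) (E only has edges inside V for a simple graph)
data Walk {n} (E : ESet n) : Fin n → Fin n → Set where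
  here  : ∀ {u} → Walk E u u
  step  : ∀ {u v w} → E u v ≡ true → Walk E v w → Walk E u w

Connected : ∀ {n} → VSet n → ESet n → Set
Connected V E = ∀ u v → V u ≡ true → V v ≡ true → Walk E u v

IsCycle : ∀ {n} → ESet n → List (Fin n) → Set
IsCycle E xs =
  (3 ≤ length xs) × Unique xs × Linked (λ u v → E u v ≡ true) xs ×
  (∀ x y → head xs ≡ just x → last xs ≡ just y → E y x ≡ true)

Acyclic : ∀ {n} → VSet n → ESet n → Set
Acyclic E' E = ¬ (Σ (List _) (IsCycle E))

IsTree : ∀ {n} → VSet n → ESet n → Set
IsTree V E =
  IsSimpleGraph V E × (∃ λ v → V v ≡ true) × Connected V E × Acyclic V E

IsTreeDecomposition : ∀ {n r} → ESet n → (Fin r → VSet n) → (Fin r → ESet n) → Set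
IsTreeDecomposition {n} {r} E Vs Es =
  (∀ i → IsTree (Vs i) (Es i)) ×
  (∀ i u v → Es i u v ≡ true → E u v ≡ true) ×
  (∀ u v → E u v ≡ true → ∃ λ i → Es i u v ≡ true) ×
  (∀ i j u v → Es i u v ≡ true → Es j u v ≡ true → i ≡ j) ×
  (∀ v → ∃ λ i → Vs i v ≡ true)

module Submission where

-- Root the tree by breadth-first search. Acyclicity forces every edge to join a vertex to its
-- parent, so a subtree is given by a set C of non-root vertices whose parents lie in C ∪ {t}
-- for a single vertex t: the piece C ∪ {t} with the parent edges of C.
--
-- Let L = ⌊k/2⌋ and let R be the set of non-root vertices not yet covered; R stays closed
-- under taking parents (up to the root). If |R| < k, then R hanging from the root is the last
-- piece. Otherwise take a lowest vertex x with at least L descendants in R and collect the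
-- subtrees of its children one by one until at least L vertices are gathered. As x is lowest,
-- each such subtree has at most L vertices, so fewer than 2L ≤ k are gathered, all hanging
-- from x.
-- Every cut removes at least L vertices, and k ≥ 4a − 2 makes the ak − 1 non-root vertices
-- fewer than k + (2a − 1)L, so 2a pieces suffice.

open import Data.Bool using (true; false)
open import Data.Bool.Properties using (∨-comm) renaming (_≟_ to _≟ᵇ_)
open import Data.Empty using (⊥; ⊥-elim)
open import Data.Fin using (Fin; zero; suc; toℕ)
open import Data.Fin.Properties using (_≟_; any?; toℕ<n; toℕ-injective)
import Data.Fin.Properties as Finₚ
open import Data.List using (List; []; _∷_; _++_; length; head; last; filterᵇ; tabulate)
open import Data.List.Properties using (length-++)
open import Data.List.Relation.Unary.All as All using (All; []; _∷_)
import Data.List.Relation.Unary.All.Properties as All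
open import Data.List.Relation.Unary.AllPairs using ([]; _∷_)
import Data.List.Relation.Unary.AllPairs.Properties as AllPairs
open import Data.List.Relation.Unary.Linked as Linked using (Linked; [-]; _∷_)
open import Data.List.Relation.Unary.Unique.Propositional using (Unique)
open import Data.Maybe using (just)
open import Data.Maybe.Properties using (just-injective)
open import Data.Nat using (ℕ; zero; suc; _+_; _*_; _∸_; _≤_; _<_; z≤n; s≤s; s≤s⁻¹; _≤?_; _<?_; ⌊_/2⌋; ⌈_/2⌉)
open import Data.Nat.Properties hiding (_≟_)
open import Data.Nat.Properties using () renaming (_≟_ to _≟ℕ_)
open import Algebra.Properties.CommutativeSemigroup +-commutativeSemigroup using (interchange; x∙yz≈y∙xz)
open import Data.Nat.Tactic.RingSolver using (solve-∀)
open import Data.Product using (Σ; ∃; _×_; _,_; proj₁; proj₂)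
open import Data.Sum using (_⊎_; inj₁; inj₂; [_,_]′; swap)
open import Data.Unit using (tt)
open import Function using (_∘_; id)
open import Level using (Level; 0ℓ)
open import Relation.Binary using (tri<; tri≈; tri>)
open import Relation.Binary.PropositionalEquality
open import Relation.Nullary using (¬_; Dec; yes; no; does; contradiction; ¬?; _×-dec_; _⊎-dec_)
open import Relation.Nullary.Decidable using (dec-true; dec-false; map′; toSum)
open import Relation.Unary using (Pred; Decidable; _∈_; _∉_; _⊆_; _∪_; _∩_; _∖_; ∅; Satisfiable)
open import Relation.Unary.Properties using (_∪?_; _∩?_; ∁?; ∅?; U?)

open import Defs

private
  variable
    ℓ p q r : Level
    n : ℕ

minimal-witness : {P : Pred ℕ ℓ} → Decidable P → ∀ {m} → P m →
  ∃ λ k → P k × (∀ {j} → j < k → ¬ P j)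
minimal-witness P? {zero} p0 = 0 , p0 , λ ()
minimal-witness P? {suc m} pm with P? 0
... | yes p0 = 0 , p0 , λ ()
... | no ¬p0 with minimal-witness (P? ∘ suc) pm
...   | k , pk , below = suc k , pk , λ { {zero} _ → ¬p0 ; {suc j} j<k → below (s≤s⁻¹ j<k) }

dec-true⁻ : ∀ {A : Set ℓ} (a? : Dec A) → does a? ≡ true → A
dec-true⁻ (yes a) _ = a

indicator : ∀ {A : Set ℓ} → Dec A → ℕ
indicator (yes _) = 1
indicator (no _) = 0

module _ {a b} {A : Set a} {B : Set b} where

  indicator-mono : (A → B) → (a? : Dec A) (b? : Dec B) → indicator a? ≤ indicator b?
  indicator-mono A→B (yes a) (no ¬b) = contradiction (A→B a) ¬b
  indicator-mono A→B (yes _) (yes _) = ≤-refl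
  indicator-mono A→B (no _)  _       = z≤n

  indicator-⊎ : ∀ {c} {C : Set c} → (A → B ⊎ C) → (a? : Dec A) (b? : Dec B) (c? : Dec C) →
    indicator a? ≤ indicator b? + indicator c?
  indicator-⊎ A→B⊎C (no _)  _       _       = z≤n
  indicator-⊎ A→B⊎C (yes _) (yes _) _       = s≤s z≤n
  indicator-⊎ A→B⊎C (yes _) (no _)  (yes _) = s≤s z≤n
  indicator-⊎ A→B⊎C (yes a) (no ¬b) (no ¬c) with A→B⊎C a
  ... | inj₁ b = contradiction b ¬b
  ... | inj₂ c = contradiction c ¬c

  indicator-disjoint : ∀ {c} {C : Set c} → (B → A) → (C → A) → (B → C → ⊥) →
    (a? : Dec A) (b? : Dec B) (c? : Dec C) → indicator b? + indicator c? ≤ indicator a?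
  indicator-disjoint B→A C→A B⊥C a?      (yes b) (yes c) = contradiction c (B⊥C b)
  indicator-disjoint B→A C→A B⊥C (no ¬a) (yes b) _       = contradiction (B→A b) ¬a
  indicator-disjoint B→A C→A B⊥C (no ¬a) (no _)  (yes c) = contradiction (C→A c) ¬a
  indicator-disjoint B→A C→A B⊥C (no _)  (no _)  (no _)  = z≤n
  indicator-disjoint B→A C→A B⊥C (yes _) (yes _) (no _)  = ≤-refl
  indicator-disjoint B→A C→A B⊥C (yes _) (no _)  (yes _) = ≤-refl
  indicator-disjoint B→A C→A B⊥C (yes _) (no _)  (no _)  = z≤n

count : {P : Pred (Fin n) ℓ} → Decidable P → ℕ
count {n = zero}  P? = 0
count {n = suc n} P? = indicator (P? zero) + count (P? ∘ suc)

count-mono : {P : Pred (Fin n) p} {Q : Pred (Fin n) q} (P? : Decidable P) (Q? : Decidable Q) →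
  P ⊆ Q → count P? ≤ count Q?
count-mono {n = zero}  _  _  _   = z≤n
count-mono {n = suc n} P? Q? P⊆Q =
  +-mono-≤ (indicator-mono (P⊆Q {zero}) (P? zero) (Q? zero))
           (count-mono (P? ∘ suc) (Q? ∘ suc) λ {x} → P⊆Q {suc x})

count-< : {P : Pred (Fin n) p} {Q : Pred (Fin n) q} (P? : Decidable P) (Q? : Decidable Q) →
  P ⊆ Q → ∀ {x} → x ∈ Q → x ∉ P → count P? < count Q?
count-< {n = suc n} P? Q? P⊆Q {zero} q ¬p with P? zero | Q? zero
... | yes p | _      = contradiction p ¬p
... | no _  | no ¬q  = contradiction q ¬q
... | no _  | yes _  = s≤s (count-mono (P? ∘ suc) (Q? ∘ suc) λ {x} → P⊆Q {suc x})
count-< {n = suc n} P? Q? P⊆Q {suc x} q ¬p =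
  +-mono-≤-< (indicator-mono (P⊆Q {zero}) (P? zero) (Q? zero))
             (count-< (P? ∘ suc) (Q? ∘ suc) (λ {y} → P⊆Q {suc y}) q ¬p)

count-∪ : {P : Pred (Fin n) p} {Q : Pred (Fin n) q} {R : Pred (Fin n) r}
  (P? : Decidable P) (Q? : Decidable Q) (R? : Decidable R) →
  P ⊆ Q ∪ R → count P? ≤ count Q? + count R?
count-∪ {n = zero}  _  _  _  _ = z≤n
count-∪ {n = suc n} P? Q? R? P⊆Q∪R = begin
  indicator (P? zero) + count (P? ∘ suc)
    ≤⟨ +-mono-≤ (indicator-⊎ (P⊆Q∪R {zero}) (P? zero) (Q? zero) (R? zero))
                (count-∪ (P? ∘ suc) (Q? ∘ suc) (R? ∘ suc) λ {x} → P⊆Q∪R {suc x}) ⟩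
  (indicator (Q? zero) + indicator (R? zero)) + (count (Q? ∘ suc) + count (R? ∘ suc))
    ≡⟨ interchange (indicator (Q? zero)) _ _ _ ⟩
  (indicator (Q? zero) + count (Q? ∘ suc)) + (indicator (R? zero) + count (R? ∘ suc)) ∎
  where open ≤-Reasoning

count-disjoint : {P : Pred (Fin n) p} {Q : Pred (Fin n) q} {R : Pred (Fin n) r}
  (P? : Decidable P) (Q? : Decidable Q) (R? : Decidable R) →
  Q ⊆ P → R ⊆ P → (∀ {x} → x ∈ Q → x ∈ R → ⊥) → count Q? + count R? ≤ count P?
count-disjoint {n = zero}  _  _  _  _   _   _   = z≤n
count-disjoint {n = suc n} P? Q? R? Q⊆P R⊆P Q⊥R = begin
  (indicator (Q? zero) + count (Q? ∘ suc)) + (indicator (R? zero) + count (R? ∘ suc))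
    ≡⟨ interchange (indicator (Q? zero)) _ _ _ ⟩
  (indicator (Q? zero) + indicator (R? zero)) + (count (Q? ∘ suc) + count (R? ∘ suc))
    ≤⟨ +-mono-≤ (indicator-disjoint (Q⊆P {zero}) (R⊆P {zero}) (Q⊥R {zero})
                                    (P? zero) (Q? zero) (R? zero))
                (count-disjoint (P? ∘ suc) (Q? ∘ suc) (R? ∘ suc)
                   (λ {x} → Q⊆P {suc x}) (λ {x} → R⊆P {suc x}) (λ {x} → Q⊥R {suc x})) ⟩
  indicator (P? zero) + count (P? ∘ suc) ∎
  where open ≤-Reasoning

count-∅ : {P : Pred (Fin n) ℓ} (P? : Decidable P) → (∀ x → x ∉ P) → count P? ≡ 0
count-∅ {n = zero}  P? empty = refl
count-∅ {n = suc n} P? empty with P? zero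
... | yes p = contradiction p (empty zero)
... | no _  = count-∅ (P? ∘ suc) (empty ∘ suc)

count-witness : {P : Pred (Fin n) ℓ} (P? : Decidable P) → 0 < count P? → Satisfiable P
count-witness {n = suc n} P? 0<count with P? zero
... | yes p = zero , p
... | no _ with count-witness (P? ∘ suc) 0<count
...   | x , p = suc x , p

count-≤1 : {P : Pred (Fin n) ℓ} (P? : Decidable P) → (∀ {x y} → x ∈ P → y ∈ P → x ≡ y) →
  count P? ≤ 1
count-≤1 {n = zero}  P? unique = z≤n
count-≤1 {n = suc n} P? unique with P? zero
... | yes p = ≤-reflexive (cong suc (count-∅ (P? ∘ suc) λ x q → Finₚ.0≢1+n (unique p q)))
... | no _  = count-≤1 (P? ∘ suc) λ p q → Finₚ.suc-injective (unique p q)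

count-U : count (U? {A = Fin n}) ≡ n
count-U {n = zero}  = refl
count-U {n = suc n} = cong suc count-U

size≡count : {P : Pred (Fin n) ℓ} (P? : Decidable P) → size (does ∘ P?) ≡ count P?
size≡count {n = n} P? = filter-tabulate id
  where
  filter-tabulate : ∀ {m} (g : Fin m → Fin n) →
    length (filterᵇ (does ∘ P?) (tabulate g)) ≡ count (P? ∘ g)
  filter-tabulate {zero}  g = refl
  filter-tabulate {suc m} g with P? (g zero)
  ... | yes _ = cong suc (filter-tabulate (g ∘ suc))
  ... | no _  = filter-tabulate (g ∘ suc)

-- parent root is an unconstrained junk value.
record Rooting (n : ℕ) : Set where
  field
    root         : Fin n
    depth        : Fin n → ℕ
    parent       : Fin n → Fin n
    depth-root   : depth root ≡ 0
    depth≡0⇒root : ∀ {v} → depth v ≡ 0 → v ≡ root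
    depth-parent : ∀ {v} → v ≢ root → depth v ≡ suc (depth (parent v))

module RootedTree {n} (ρ : Rooting n) where

  open Rooting ρ

  private
    variable
      c v w x y : Fin n
      R : Pred (Fin n) 0ℓ

  depth≡suc⇒≢root : ∀ {m} → depth v ≡ suc m → v ≢ root
  depth≡suc⇒≢root d≡ refl = 0≢1+n (trans (sym depth-root) d≡)

  parent≢self : v ≢ root → parent v ≢ v
  parent≢self v≢r pv≡v = 1+n≢n (trans (sym (depth-parent v≢r)) (cong depth (sym pv≡v)))

  depth-induction : (P : Pred (Fin n) ℓ) → P root → (∀ {v} → v ≢ root → P (parent v) → P v) →
    ∀ v → P v
  depth-induction P at-root at-child v = go (depth v) refl
    where
    go : ∀ m {v} → depth v ≡ m → P v
    go zero    d≡0 = subst P (sym (depth≡0⇒root d≡0)) at-root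
    go (suc m) d≡  = at-child v≢r (go m (suc-injective (trans (sym (depth-parent v≢r)) d≡)))
      where v≢r = depth≡suc⇒≢root d≡

  infix 4 _≼_ _≺_

  data _≼_ (x : Fin n) : Fin n → Set where
    ≼-refl   : x ≼ x
    ≼-parent : v ≢ root → x ≼ parent v → x ≼ v

  _≺_ : Fin n → Fin n → Set
  x ≺ v = v ≢ root × x ≼ parent v

  Child : Fin n → Pred (Fin n) 0ℓ
  Child x c = c ≢ root × parent c ≡ x

  ≼-depth : x ≼ v → depth x ≤ depth v
  ≼-depth ≼-refl              = ≤-refl
  ≼-depth (≼-parent v≢r x≼pv) =
    ≤-trans (m≤n⇒m≤1+n (≼-depth x≼pv)) (≤-reflexive (sym (depth-parent v≢r)))

  ≺-depth : x ≺ v → depth x < depth v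
  ≺-depth (v≢r , x≼pv) = ≤-trans (s≤s (≼-depth x≼pv)) (≤-reflexive (sym (depth-parent v≢r)))

  ≺-irrefl : ¬ v ≺ v
  ≺-irrefl v≺v = <-irrefl refl (≺-depth v≺v)

  ≺⇒≼ : x ≺ v → x ≼ v
  ≺⇒≼ (v≢r , x≼pv) = ≼-parent v≢r x≼pv

  ≼-trans : x ≼ y → y ≼ v → x ≼ v
  ≼-trans x≼y ≼-refl              = x≼y
  ≼-trans x≼y (≼-parent v≢r y≼pv) = ≼-parent v≢r (≼-trans x≼y y≼pv)

  ≺-≼-trans : x ≺ y → y ≼ v → x ≺ v
  ≺-≼-trans x≺y ≼-refl              = x≺y
  ≺-≼-trans x≺y (≼-parent v≢r y≼pv) = v≢r , ≼-trans (≺⇒≼ x≺y) y≼pv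

  child⇒≺ : Child x c → x ≺ c
  child⇒≺ (c≢r , refl) = c≢r , ≼-refl

  child-asym : Child x y → ¬ Child y x
  child-asym y-child x-child = <-asym (≺-depth (child⇒≺ y-child)) (≺-depth (child⇒≺ x-child))

  ≼-root : x ≼ root → x ≡ root
  ≼-root ≼-refl             = refl
  ≼-root (≼-parent r≢r _) = contradiction refl r≢r

  root-≼ : ∀ v → root ≼ v
  root-≼ = depth-induction (root ≼_) ≼-refl ≼-parent

  ≺⇒child-≼ : x ≺ v → ∃ λ c → Child x c × c ≼ v
  ≺⇒child-≼ {x} (v≢r , x≼pv) = go v≢r refl x≼pv
    where
    go : v ≢ root → parent v ≡ w → x ≼ w → ∃ λ c → Child x c × c ≼ v
    go v≢r pv≡w ≼-refl = _ , (v≢r , pv≡w) , ≼-refl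
    go v≢r pv≡w (≼-parent w≢r x≼pw) with go w≢r refl x≼pw
    ... | c , c-child , c≼w = c , c-child , ≼-parent v≢r (subst (c ≼_) (sym pv≡w) c≼w)

  _≼?_ : ∀ x → Decidable (x ≼_)
  x ≼? u = depth-induction (λ v → Dec (x ≼ v)) at-root at-child u
    where
    at-root : Dec (x ≼ root)
    at-root = map′ (λ x≡r → subst (x ≼_) x≡r ≼-refl) ≼-root (x ≟ root)
    at-child : v ≢ root → Dec (x ≼ parent v) → Dec (x ≼ v)
    at-child {v} v≢r x≼?pv with x ≟ v
    ... | yes refl = yes ≼-refl
    ... | no x≢v   = map′ (≼-parent v≢r) climb x≼?pv
      where
      climb : x ≼ v → x ≼ parent v
      climb ≼-refl            = contradiction refl x≢v
      climb (≼-parent _ x≼pv) = x≼pv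

  _≺?_ : ∀ x → Decidable (x ≺_)
  x ≺? v = ¬? (v ≟ root) ×-dec (x ≼? parent v)

  child? : ∀ x → Decidable (Child x)
  child? x c = ¬? (c ≟ root) ×-dec (parent c ≟ x)

  Hangs : Pred (Fin n) 0ℓ → Fin n → Set
  Hangs C t = ∀ {v} → v ∈ C → parent v ≡ t ⊎ parent v ∈ C

  UpClosed : Pred (Fin n) 0ℓ → Set
  UpClosed R = root ∉ R × Hangs R root

  ∈⇒≢root : UpClosed R → v ∈ R → v ≢ root
  ∈⇒≢root (r∉R , _) v∈R refl = r∉R v∈R

  ≼-closed : UpClosed R → v ∈ R → x ≼ v → x ≢ root → x ∈ R
  ≼-closed R-up v∈R ≼-refl x≢r = v∈R
  ≼-closed R-up v∈R (≼-parent v≢r x≼pv) x≢r with proj₂ R-up v∈R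
  ... | inj₁ pv≡r = contradiction (≼-root (subst (_ ≼_) pv≡r x≼pv)) x≢r
  ... | inj₂ pv∈R = ≼-closed R-up pv∈R x≼pv x≢r

  record Chunk (R : Pred (Fin n) 0ℓ) (L : ℕ) : Set₁ where
    field
      S           : Pred (Fin n) 0ℓ
      S?          : Decidable S
      top         : Fin n
      S⊆R         : S ⊆ R
      hangs       : Hangs S top
      down-closed : ∀ {v} → v ∈ R → parent v ∈ S → v ∈ S
      large       : L ≤ count S?
      small       : count S? < L + L

  module Chunking {R} (R? : Decidable R) (R-up : UpClosed R) {L} (L≥1 : 1 ≤ L) where

    Below : Fin n → Pred (Fin n) 0ℓ
    Below x = R ∩ (x ≺_)

    below? : ∀ x → Decidable (Below x)
    below? x = R? ∩? (x ≺?_)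

    Subtree : Fin n → Pred (Fin n) 0ℓ
    Subtree x = R ∩ (x ≼_)

    subtree? : ∀ x → Decidable (Subtree x)
    subtree? x = R? ∩? (x ≼?_)

    Heavy : Pred (Fin n) 0ℓ
    Heavy x = L ≤ count (below? x)

    heavy? : Decidable Heavy
    heavy? x = L ≤? count (below? x)

    heavy-root : L ≤ count R? → Heavy root
    heavy-root L≤|R| = ≤-trans L≤|R| (count-mono R? (below? root) R⊆Below-root)
      where
      R⊆Below-root : R ⊆ Below root
      R⊆Below-root {v} v∈R = v∈R , ∈⇒≢root R-up v∈R , root-≼ (parent v)

    heavy-child-lighter : Child x c → Heavy c → count (below? c) < count (below? x)
    heavy-child-lighter {x} {c} c-child c-heavy =
      count-< (below? c) (below? x) Below-c⊆Below-x (c∈R , child⇒≺ c-child) (≺-irrefl ∘ proj₂)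
      where
      Below-c⊆Below-x : Below c ⊆ Below x
      Below-c⊆Below-x (u∈R , c≺u) = u∈R , ≺-≼-trans (child⇒≺ c-child) (≺⇒≼ c≺u)
      c∈R : c ∈ R
      c∈R with count-witness (below? c) (≤-trans L≥1 c-heavy)
      ... | u , u∈R , c≺u = ≼-closed R-up u∈R (≺⇒≼ c≺u) (proj₁ c-child)

    lowest-heavy : Heavy x → ∃ λ x → Heavy x × ∀ {c} → Child x c → ¬ Heavy c
    lowest-heavy {x} = descend (count (below? x)) ≤-refl
      where
      descend : ∀ m {x} → count (below? x) ≤ m → Heavy x →
        ∃ λ x → Heavy x × ∀ {c} → Child x c → ¬ Heavy c
      descend m {x} |x|≤m x-heavy with any? (child? x ∩? heavy?)
      ... | no ¬heavy-child = x , x-heavy , λ c-child c-heavy → ¬heavy-child (_ , c-child , c-heavy)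
      ... | yes (c , c-child , c-heavy) with m | <-≤-trans (heavy-child-lighter c-child c-heavy) |x|≤m
      ...   | suc m | |c|<1+m = descend m (s≤s⁻¹ |c|<1+m) c-heavy

    module Branching (x : Fin n) (x-heavy : Heavy x) (light : ∀ {c} → Child x c → ¬ Heavy c) where

      Branches : ℕ → Pred (Fin n) 0ℓ
      Branches j u = u ∈ R × ∃ λ c → Child x c × toℕ c < j × c ≼ u

      branches? : ∀ j → Decidable (Branches j)
      branches? j u = R? u ×-dec any? (λ c → child? x c ×-dec toℕ c <? j ×-dec c ≼? u)

      branches-hang : ∀ {j} → Hangs (Branches j) x
      branches-hang (v∈R , c , c-child , c<j , ≼-refl) = inj₁ (proj₂ c-child)
      branches-hang (v∈R , c , c-child , c<j , ≼-parent v≢r c≼pv) with proj₂ R-up v∈R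
      ... | inj₁ pv≡r = contradiction (≼-root (subst (c ≼_) pv≡r c≼pv)) (proj₁ c-child)
      ... | inj₂ pv∈R = inj₂ (pv∈R , c , c-child , c<j , c≼pv)

      branches-down : ∀ {j v} → v ∈ R → parent v ∈ Branches j → v ∈ Branches j
      branches-down v∈R (_ , c , c-child , c<j , c≼pv) =
        v∈R , c , c-child , c<j , ≼-parent (∈⇒≢root R-up v∈R) c≼pv

      Below⊆Branches : Below x ⊆ Branches n
      Below⊆Branches (u∈R , x≺u) with ≺⇒child-≼ x≺u
      ... | c , c-child , c≼u = u∈R , c , c-child , toℕ<n c , c≼u

      no-branches : count (branches? 0) ≡ 0
      no-branches = count-∅ (branches? 0) λ { _ (_ , _ , _ , () , _) }

      all-branches-heavy : L ≤ count (branches? n)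
      all-branches-heavy = ≤-trans x-heavy (count-mono (below? x) (branches? n) Below⊆Branches)

      subtree-small : Child x c → count (subtree? c) ≤ L
      subtree-small {c} c-child = begin
        count (subtree? c)               ≤⟨ count-∪ (subtree? c) (c ≟_) (below? c) self-or-below ⟩
        count (c ≟_) + count (below? c)  ≤⟨ +-monoˡ-≤ _ (count-≤1 (c ≟_) λ c≡u c≡v → trans (sym c≡u) c≡v) ⟩
        suc (count (below? c))           ≤⟨ ≰⇒> (light c-child) ⟩
        L                                ∎
        where
        open ≤-Reasoning
        self-or-below : Subtree c ⊆ (c ≡_) ∪ Below c
        self-or-below (u∈R , ≼-refl)              = inj₁ refl
        self-or-below (u∈R , ≼-parent u≢r c≼pu) = inj₂ (u∈R , u≢r , c≼pu)

      branches-suc : ∀ {j} →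
        Branches (suc j) ⊆ Branches j ∪ (λ u → ∃ λ c → Child x c × toℕ c ≡ j × u ∈ Subtree c)
      branches-suc (u∈R , c , c-child , c<1+j , c≼u) with m<1+n⇒m<n∨m≡n c<1+j
      ... | inj₁ c<j = inj₁ (u∈R , c , c-child , c<j , c≼u)
      ... | inj₂ c≡j = inj₂ (c , c-child , c≡j , u∈R , c≼u)

      branches-step : ∀ j → count (branches? (suc j)) ≤ count (branches? j) + L
      branches-step j with any? (λ c → child? x c ×-dec toℕ c ≟ℕ j)
      ... | yes (c , c-child , c≡j) =
        ≤-trans (count-∪ (branches? (suc j)) (branches? j) (subtree? c) old-or-c)
                (+-monoʳ-≤ _ (subtree-small c-child))
        where
        old-or-c : Branches (suc j) ⊆ Branches j ∪ Subtree c
        old-or-c u∈B with branches-suc u∈B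
        ... | inj₁ u∈Bj = inj₁ u∈Bj
        ... | inj₂ (c′ , _ , c′≡j , u∈R , c′≼u) =
          inj₂ (u∈R , subst (_≼ _) (toℕ-injective (trans c′≡j (sym c≡j))) c′≼u)
      ... | no ∄c = ≤-trans (count-mono (branches? (suc j)) (branches? j) old) (m≤m+n _ L)
        where
        old : Branches (suc j) ⊆ Branches j
        old u∈B with branches-suc u∈B
        ... | inj₁ u∈Bj = u∈Bj
        ... | inj₂ (c , c-child , c≡j , _) = contradiction (c , c-child , c≡j) ∄c

      chunk : Chunk R L
      chunk with minimal-witness (λ j → L ≤? count (branches? j)) all-branches-heavy
      ... | zero  , L≤|B₀| , _       = contradiction (subst (L ≤_) no-branches L≤|B₀|) (<⇒≱ L≥1)
      ... | suc j , L≤|B|  , lighter = record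
        { S           = Branches (suc j)
        ; S?          = branches? (suc j)
        ; top         = x
        ; S⊆R         = proj₁
        ; hangs       = branches-hang
        ; down-closed = branches-down
        ; large       = L≤|B|
        ; small       = ≤-<-trans (branches-step j) (+-monoˡ-< L (≰⇒> (lighter ≤-refl)))
        }

    chunk : L ≤ count R? → Chunk R L
    chunk L≤|R| with lowest-heavy (heavy-root L≤|R|)
    ... | x , x-heavy , light = Branching.chunk x x-heavy light

  -- Piece i consists of part i and top i, with the edges joining each vertex of part i to its parent.
  record Decomposition (R : Pred (Fin n) 0ℓ) (m k : ℕ) : Set₁ where
    field
      part     : Fin m → Pred (Fin n) 0ℓ
      part?    : ∀ i → Decidable (part i)
      top      : Fin m → Fin n
      part⊆R   : ∀ i → part i ⊆ R
      covered  : ∀ {v} → v ∈ R → ∃ λ i → v ∈ part i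
      disjoint : ∀ {i j v} → v ∈ part i → v ∈ part j → i ≡ j
      hangs    : ∀ i → Hangs (part i) (top i)
      small    : ∀ i → count (part? i) < k
      root-top : ∃ λ i → top i ≡ root

  module Decomposing {k L} (L≥1 : 1 ≤ L) (L+L≤k : L + L ≤ k) where

    single-piece : ∀ {m R} (R? : Decidable R) → UpClosed R → count R? < k → Decomposition R (suc m) k
    single-piece {m} {R} R? R-up |R|<k = record
      { part     = part
      ; part?    = part?
      ; top      = λ _ → root
      ; part⊆R   = part⊆R
      ; covered  = λ v∈R → zero , v∈R
      ; disjoint = disjoint
      ; hangs    = hangs
      ; small    = small
      ; root-top = zero , refl
      }
      where
      part : Fin (suc m) → Pred (Fin n) 0ℓ
      part zero    = R
      part (suc _) = ∅
      part? : ∀ i → Decidable (part i)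
      part? zero    = R?
      part? (suc _) = ∅?
      part⊆R : ∀ i → part i ⊆ R
      part⊆R zero    v∈R = v∈R
      part⊆R (suc _) ()
      disjoint : ∀ {i j v} → v ∈ part i → v ∈ part j → i ≡ j
      disjoint {zero}  {zero} _ _ = refl
      disjoint {suc _} ()
      disjoint {_} {suc _} _ ()
      hangs : ∀ i → Hangs (part i) root
      hangs zero    = proj₂ R-up
      hangs (suc _) ()
      small : ∀ i → count (part? i) < k
      small zero    = |R|<k
      small (suc _) = ≤-<-trans (count-mono ∅? R? λ ()) |R|<k

    module _ {R} (R? : Decidable R) (C : Chunk R L) where

      open Chunk C

      rest? : Decidable (R ∖ S)
      rest? = R? ∩? ∁? S?

      rest-up-closed : UpClosed R → UpClosed (R ∖ S)
      rest-up-closed (r∉R , R-hangs) = r∉R ∘ proj₁ , rest-hangs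
        where
        rest-hangs : Hangs (R ∖ S) root
        rest-hangs (v∈R , v∉S) with R-hangs v∈R
        ... | inj₁ pv≡r = inj₁ pv≡r
        ... | inj₂ pv∈R = inj₂ (pv∈R , v∉S ∘ down-closed v∈R)

      rest-smaller : ∀ j → count R? < k + suc j * L → count rest? < k + j * L
      rest-smaller j |R|< = +-cancelˡ-< L _ _ (begin-strict
        L + count rest?         ≤⟨ +-monoˡ-≤ _ large ⟩
        count S? + count rest?  ≤⟨ count-disjoint R? S? rest? S⊆R proj₁ (λ s∈S (_ , s∉S) → s∉S s∈S) ⟩
        count R?                <⟨ |R|< ⟩
        k + (L + j * L)         ≡⟨ x∙yz≈y∙xz k L (j * L) ⟩
        L + (k + j * L)         ∎)
        where open ≤-Reasoning

      extend : ∀ {m} → Decomposition (R ∖ S) m k → Decomposition R (suc m) k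
      extend {m} D = record
        { part     = part′
        ; part?    = part?′
        ; top      = top′
        ; part⊆R   = part⊆R′
        ; covered  = covered′
        ; disjoint = disjoint′
        ; hangs    = hangs′
        ; small    = small′
        ; root-top = suc (proj₁ D.root-top) , proj₂ D.root-top
        }
        where
        module D = Decomposition D
        part′ : Fin (suc m) → Pred (Fin n) 0ℓ
        part′ zero    = S
        part′ (suc i) = D.part i
        part?′ : ∀ i → Decidable (part′ i)
        part?′ zero    = S?
        part?′ (suc i) = D.part? i
        top′ : Fin (suc m) → Fin n
        top′ zero    = top
        top′ (suc i) = D.top i
        part⊆R′ : ∀ i → part′ i ⊆ R
        part⊆R′ zero    = S⊆R
        part⊆R′ (suc i) = proj₁ ∘ D.part⊆R i
        covered′ : ∀ {v} → v ∈ R → ∃ λ i → v ∈ part′ i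
        covered′ {v} v∈R with S? v
        ... | yes v∈S = zero , v∈S
        ... | no v∉S with D.covered (v∈R , v∉S)
        ...   | i , v∈i = suc i , v∈i
        disjoint′ : ∀ {i j v} → v ∈ part′ i → v ∈ part′ j → i ≡ j
        disjoint′ {zero}  {zero}  _   _   = refl
        disjoint′ {zero}  {suc j} v∈S v∈D = contradiction v∈S (proj₂ (D.part⊆R j v∈D))
        disjoint′ {suc i} {zero}  v∈D v∈S = contradiction v∈S (proj₂ (D.part⊆R i v∈D))
        disjoint′ {suc i} {suc j} v∈i v∈j = cong suc (D.disjoint v∈i v∈j)
        hangs′ : ∀ i → Hangs (part′ i) (top′ i)
        hangs′ zero    = hangs
        hangs′ (suc i) = D.hangs i
        small′ : ∀ i → count (part?′ i) < k
        small′ zero    = <-≤-trans small L+L≤k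
        small′ (suc i) = D.small i

    decompose : ∀ j {R} (R? : Decidable R) → UpClosed R → count R? < k + j * L →
      Decomposition R (suc j) k
    decompose j R? R-up |R|< with count R? <? k
    ... | yes |R|<k = single-piece R? R-up |R|<k
    decompose zero R? R-up |R|< | no |R|≮k =
      contradiction (subst (count R? <_) (+-identityʳ k) |R|<) |R|≮k
    decompose (suc j) R? R-up |R|< | no |R|≮k =
      extend R? C (decompose j (rest? R? C) (rest-up-closed R? C R-up) (rest-smaller R? C j |R|<))
      where
      C : Chunk _ L
      C = Chunking.chunk R? R-up L≥1 (≤-trans (m≤m+n L L) (≤-trans L+L≤k (≮⇒≥ |R|≮k)))

module BreadthFirst {n} {E : ESet n} (E-sym : ∀ u v → E u v ≡ E v u) (r : Fin n)
  (reach : ∀ v → Walk E r v) where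

  Within : ℕ → Pred (Fin n) 0ℓ
  Within zero    v = v ≡ r
  Within (suc m) v = Within m v ⊎ ∃ λ u → Within m u × E u v ≡ true

  within? : ∀ m → Decidable (Within m)
  within? zero    v = v ≟ r
  within? (suc m) v = within? m v ⊎-dec any? (λ u → within? m u ×-dec E u v ≟ᵇ true)

  walk-within : ∀ {m u v} → Within m u → Walk E u v → ∃ λ m → Within m v
  walk-within w here          = _ , w
  walk-within w (step e walk) = walk-within (inj₂ (_ , w , e)) walk

  private
    nearest : ∀ v → ∃ λ m → Within m v × ∀ {j} → j < m → ¬ Within j v
    nearest v = minimal-witness (λ m → within? m v) (proj₂ (walk-within refl (reach v)))

  distance : Fin n → ℕ
  distance v = proj₁ (nearest v)

  within-distance : ∀ v → Within (distance v) v
  within-distance v = proj₁ (proj₂ (nearest v))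

  distance-minimal : ∀ {m v} → Within m v → distance v ≤ m
  distance-minimal {v = v} w = ≮⇒≥ λ m<d → proj₂ (proj₂ (nearest v)) m<d w

  distance-adjacent : ∀ {u v} → E u v ≡ true → distance v ≤ suc (distance u)
  distance-adjacent e = distance-minimal (inj₂ (_ , within-distance _ , e))

  predecessor : ∀ {v} → v ≢ r → ∃ λ u → E v u ≡ true × distance v ≡ suc (distance u)
  predecessor {v} v≢r with distance v in d≡ | within-distance v
  ... | zero  | v≡r                  = contradiction v≡r v≢r
  ... | suc m | inj₁ w               = contradiction (subst (_≤ m) d≡ (distance-minimal w)) 1+n≰n
  ... | suc m | inj₂ (u , w , u-v) =
    u , trans (E-sym v u) u-v , cong suc (≤-antisym m≤d (distance-minimal w))
    where
    m≤d : m ≤ distance u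
    m≤d = s≤s⁻¹ (subst (_≤ suc (distance u)) d≡ (distance-adjacent u-v))

  parent : Fin n → Fin n
  parent v with v ≟ r
  ... | yes _  = r
  ... | no v≢r = proj₁ (predecessor v≢r)

  parent-spec : ∀ {v} → v ≢ r → E v (parent v) ≡ true × distance v ≡ suc (distance (parent v))
  parent-spec {v} v≢r with v ≟ r
  ... | yes v≡r  = contradiction v≡r v≢r
  ... | no v≢r′ = proj₂ (predecessor v≢r′)

  rooting : Rooting n
  rooting = record
    { root         = r
    ; depth        = distance
    ; parent       = parent
    ; depth-root   = n≤0⇒n≡0 (distance-minimal refl)
    ; depth≡0⇒root = λ {v} d≡0 → subst (λ m → Within m v) d≡0 (within-distance v)
    ; depth-parent = proj₂ ∘ parent-spec
    }

module ParentEdges {n} {E : ESet n} (E-sym : ∀ u v → E u v ≡ E v u) (E-loopless : ∀ u → E u u ≡ false)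
  (acyclic : ¬ Σ (List (Fin n)) (IsCycle E)) (ρ : Rooting n)
  (parent-adjacent : ∀ {v} → v ≢ Rooting.root ρ → E v (Rooting.parent ρ v) ≡ true)
  (depth-adjacent : ∀ {u v} → E u v ≡ true → Rooting.depth ρ v ≤ suc (Rooting.depth ρ u)) where

  open Rooting ρ
  open RootedTree ρ using (depth≡suc⇒≢root; Child)

  private
    variable
      m : ℕ
      u v x y z : Fin n
      vs : List (Fin n)

  data Path : Fin n → List (Fin n) → Fin n → Set where
    end  : Path x (x ∷ []) x
    edge : E x y ≡ true → Path y vs z → Path x (x ∷ vs) z

  path-head : Path x vs y → head vs ≡ just x
  path-head end        = refl
  path-head (edge _ _) = refl

  path-last : Path x vs y → last vs ≡ just y
  path-last end                 = refl
  path-last (edge _ end)        = refl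
  path-last (edge _ p@(edge _ _)) = path-last p

  path-linked : Path x vs y → Linked (λ u v → E u v ≡ true) vs
  path-linked end                   = [-]
  path-linked (edge e end)          = e ∷ [-]
  path-linked (edge e p@(edge _ _)) = e ∷ path-linked p

  path-snoc : Path x vs y → E y z ≡ true → Path x (vs ++ z ∷ []) z
  path-snoc end        e = edge e end
  path-snoc (edge e p) e′ = edge e (path-snoc p e′)

  path-nonempty : Path x vs y → 1 ≤ length vs
  path-nonempty end        = s≤s z≤n
  path-nonempty (edge _ _) = s≤s z≤n

  no-closed-path : Path x vs y → Unique vs → 3 ≤ length vs → E y x ≡ true → ⊥
  no-closed-path {vs = vs} p unique long y-x = acyclic (vs , long , unique , path-linked p , closes)
    where
    closes : ∀ a b → head vs ≡ just a → last vs ≡ just b → E b a ≡ true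
    closes a b h l = subst₂ (λ a b → E b a ≡ true)
      (just-injective (trans (sym (path-head p)) h)) (just-injective (trans (sym (path-last p)) l)) y-x

  parent-depth : depth v ≡ suc m → depth (parent v) ≡ m
  parent-depth d≡ = suc-injective (trans (sym (depth-parent (depth≡suc⇒≢root d≡))) d≡)

  deeper-∉ : All (λ u → depth u ≤ m) vs → depth v ≡ suc m → All (_≢ v) vs
  deeper-∉ shallow d≡ =
    All.map (λ d≤m u≡v → 1+n≰n (subst (_≤ _) (trans (cong depth u≡v) d≡) d≤m)) shallow

  record Chain (x y : Fin n) (m : ℕ) : Set where
    field
      vertices : List (Fin n)
      path     : Path x vertices y
      unique   : Unique vertices
      shallow  : All (λ u → depth u ≤ m) vertices

  open Chain

  widen : depth x ≡ suc m → depth y ≡ suc m → x ≢ y → Chain (parent x) (parent y) m →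
    Σ (Chain x y (suc m)) λ C → 3 ≤ length (vertices C)
  widen {x = x} {y = y} dx dy x≢y C = record
    { vertices = x ∷ vertices C ++ y ∷ []
    ; path     = edge (parent-adjacent (depth≡suc⇒≢root dx))
                      (path-snoc (path C) (trans (E-sym _ y) (parent-adjacent (depth≡suc⇒≢root dy))))
    ; unique   = All.++⁺ (All.map ≢-sym (deeper-∉ (shallow C) dx)) (x≢y ∷ [])
               ∷ AllPairs.++⁺ (unique C) ([] ∷ []) (All.map (_∷ []) (deeper-∉ (shallow C) dy))
    ; shallow  = ≤-reflexive dx ∷ All.++⁺ (All.map m≤n⇒m≤1+n (shallow C)) (≤-reflexive dy ∷ [])
    } , s≤s (subst (2 ≤_) (sym (length-++ (vertices C))) (+-monoˡ-≤ 1 (path-nonempty (path C))))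

  bridge : depth x ≡ m → depth y ≡ m → x ≢ y → Σ (Chain x y m) λ C → 3 ≤ length (vertices C)
  chain : depth x ≡ m → depth y ≡ m → Chain x y m

  bridge {m = zero}  dx dy x≢y = contradiction (trans (depth≡0⇒root dx) (sym (depth≡0⇒root dy))) x≢y
  bridge {m = suc m} dx dy x≢y = widen dx dy x≢y (chain (parent-depth dx) (parent-depth dy))

  chain {x = x} {y = y} dx dy with x ≟ y
  ... | yes refl = record
    { vertices = x ∷ []
    ; path     = end
    ; unique   = [] ∷ []
    ; shallow  = ≤-reflexive dx ∷ []
    }
  ... | no x≢y   = proj₁ (bridge dx dy x≢y)

  adjacent⇒≢ : E u v ≡ true → u ≢ v
  adjacent⇒≢ {u} u-u refl = contradiction (trans (sym u-u) (E-loopless u)) λ ()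

  no-level-edge : E u v ≡ true → depth u ≢ depth v
  no-level-edge {u} {v} u-v du≡dv with bridge refl (sym du≡dv) (adjacent⇒≢ u-v)
  ... | C , long = no-closed-path (path C) (unique C) long (trans (E-sym v u) u-v)

  parent-of-deeper-neighbour : E u v ≡ true → depth v ≡ suc (depth u) → parent v ≡ u
  parent-of-deeper-neighbour {u} {v} u-v dv with parent v ≟ u
  ... | yes pv≡u = pv≡u
  ... | no pv≢u with bridge (parent-depth dv) refl pv≢u
  ...   | C , long = ⊥-elim (no-closed-path
            (edge (parent-adjacent v≢r) (path C))
            (All.map ≢-sym (deeper-∉ (shallow C) dv) ∷ unique C)
            (m≤n⇒m≤1+n long) u-v)
    where
    v≢r : v ≢ root
    v≢r = depth≡suc⇒≢root dv

  parent-edge : E u v ≡ true → Child v u ⊎ Child u v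
  parent-edge {u} {v} u-v with <-cmp (depth u) (depth v)
  ... | tri≈ _ du≡dv _ = contradiction du≡dv (no-level-edge u-v)
  ... | tri< du<dv _ _ = inj₂ (depth≡suc⇒≢root dv , parent-of-deeper-neighbour u-v dv)
    where dv = ≤-antisym (depth-adjacent u-v) du<dv
  ... | tri> _ _ dv<du = inj₁ (depth≡suc⇒≢root du , parent-of-deeper-neighbour v-u du)
    where v-u = trans (E-sym v u) u-v
          du = ≤-antisym (depth-adjacent v-u) dv<du

walk-++ : ∀ {E : ESet n} {u v w} → Walk E u v → Walk E v w → Walk E u w
walk-++ here           walk = walk
walk-++ (step e walk₁) walk = step e (walk-++ walk₁ walk)

walk-reverse : ∀ {E : ESet n} → (∀ u v → E u v ≡ E v u) → ∀ {u v} → Walk E u v → Walk E v u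
walk-reverse E-sym here                       = here
walk-reverse E-sym (step {u} {v} u-v walk) =
  walk-++ (walk-reverse E-sym walk) (step (trans (E-sym v u) u-v) here)

cycle-mono : ∀ {F G : ESet n} → (∀ {u v} → F u v ≡ true → G u v ≡ true) →
  ∀ {xs} → IsCycle F xs → IsCycle G xs
cycle-mono F⊆G (long , unique , linked , closes) =
  long , unique , Linked.map F⊆G linked , λ x y h l → F⊆G (closes x y h l)

module Pieces {n} {E : ESet n} (E-sym : ∀ u v → E u v ≡ E v u)
  (acyclic : ¬ Σ (List (Fin n)) (IsCycle E)) (ρ : Rooting n)
  (parent-adjacent : ∀ {v} → v ≢ Rooting.root ρ → E v (Rooting.parent ρ v) ≡ true)
  (parent-edge : ∀ {u v} → E u v ≡ true → RootedTree.Child ρ v u ⊎ RootedTree.Child ρ u v)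
  {m k} (D : RootedTree.Decomposition ρ (_≢ Rooting.root ρ) m k) where

  open Rooting ρ
  open RootedTree ρ
  open Decomposition D

  Vertex : Fin m → Pred (Fin n) 0ℓ
  Vertex i = part i ∪ (_≡ top i)

  vertex? : ∀ i → Decidable (Vertex i)
  vertex? i = part? i ∪? (_≟ top i)

  ParentEdge : Fin m → Fin n → Fin n → Set
  ParentEdge i u v = u ∈ part i × parent u ≡ v

  parentEdge? : ∀ i u v → Dec (ParentEdge i u v)
  parentEdge? i u v = part? i u ×-dec parent u ≟ v

  Vs : Fin m → VSet n
  Vs i v = does (vertex? i v)

  Es : Fin m → ESet n
  Es i u v = does (parentEdge? i u v ⊎-dec parentEdge? i v u)

  Es⁺ : ∀ {i u v} → ParentEdge i u v ⊎ ParentEdge i v u → Es i u v ≡ true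
  Es⁺ {i} {u} {v} = dec-true (parentEdge? i u v ⊎-dec parentEdge? i v u)

  Es⁻ : ∀ {i u v} → Es i u v ≡ true → ParentEdge i u v ⊎ ParentEdge i v u
  Es⁻ {i} {u} {v} = dec-true⁻ (parentEdge? i u v ⊎-dec parentEdge? i v u)

  part-≢root : ∀ {i v} → v ∈ part i → v ≢ root
  part-≢root {i} = part⊆R i

  parent-vertex : ∀ {i v} → v ∈ part i → parent v ∈ Vertex i
  parent-vertex {i} v∈i = swap (hangs i v∈i)

  Es-loopless : ∀ i u → Es i u u ≡ false
  Es-loopless i u = dec-false (parentEdge? i u u ⊎-dec parentEdge? i u u) [ loop , loop ]′
    where
    loop : ¬ ParentEdge i u u
    loop (u∈i , pu≡u) = parent≢self (part-≢root u∈i) pu≡u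

  Es⇒Vs : ∀ i u v → Es i u v ≡ true → Vs i u ≡ true
  Es⇒Vs i u v e = dec-true (vertex? i u) (endpoint (Es⁻ e))
    where
    endpoint : ParentEdge i u v ⊎ ParentEdge i v u → u ∈ Vertex i
    endpoint (inj₁ (u∈i , _))    = inj₁ u∈i
    endpoint (inj₂ (v∈i , refl)) = parent-vertex v∈i

  Es⊆E : ∀ i u v → Es i u v ≡ true → E u v ≡ true
  Es⊆E i u v e with Es⁻ e
  ... | inj₁ (u∈i , refl) = parent-adjacent (part-≢root u∈i)
  ... | inj₂ (v∈i , refl) = trans (E-sym u v) (parent-adjacent (part-≢root v∈i))

  walk-to-top : ∀ i v → v ∈ Vertex i → Walk (Es i) v (top i)
  walk-to-top i = depth-induction (λ v → v ∈ Vertex i → Walk (Es i) v (top i)) at-root at-child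
    where
    at-root : root ∈ Vertex i → Walk (Es i) root (top i)
    at-root (inj₁ r∈i)  = contradiction refl (part-≢root r∈i)
    at-root (inj₂ r≡t)  = subst (Walk (Es i) root) r≡t here
    at-child : ∀ {v} → v ≢ root → (parent v ∈ Vertex i → Walk (Es i) (parent v) (top i)) →
      v ∈ Vertex i → Walk (Es i) v (top i)
    at-child _ walk (inj₁ v∈i) = step (Es⁺ (inj₁ (v∈i , refl))) (walk (parent-vertex v∈i))
    at-child _ _    (inj₂ refl) = here

  piece-tree : ∀ i → IsTree (Vs i) (Es i)
  piece-tree i =
    (Es-sym , Es-loopless i , Es⇒Vs i) ,
    (top i , dec-true (vertex? i (top i)) (inj₂ refl)) ,
    (λ u v u∈i v∈i → walk-++ (walk-to-top′ u u∈i) (walk-reverse Es-sym (walk-to-top′ v v∈i))) ,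
    λ (xs , cycle) → acyclic (xs , cycle-mono (Es⊆E i _ _) cycle)
    where
    Es-sym : ∀ u v → Es i u v ≡ Es i v u
    Es-sym u v = ∨-comm (does (parentEdge? i u v)) _
    walk-to-top′ : ∀ v → Vs i v ≡ true → Walk (Es i) v (top i)
    walk-to-top′ v v∈i = walk-to-top i v (dec-true⁻ (vertex? i v) v∈i)

  edge-covered : ∀ u v → E u v ≡ true → ∃ λ i → Es i u v ≡ true
  edge-covered u v u-v with parent-edge u-v
  ... | inj₁ (u≢r , pu≡v) = let i , u∈i = covered u≢r in i , Es⁺ (inj₁ (u∈i , pu≡v))
  ... | inj₂ (v≢r , pv≡u) = let i , v∈i = covered v≢r in i , Es⁺ (inj₂ (v∈i , pv≡u))

  edge-unique : ∀ i j u v → Es i u v ≡ true → Es j u v ≡ true → i ≡ j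
  edge-unique i j u v e e′ with Es⁻ e | Es⁻ e′
  ... | inj₁ (u∈i , _)   | inj₁ (u∈j , _)   = disjoint u∈i u∈j
  ... | inj₂ (v∈i , _)   | inj₂ (v∈j , _)   = disjoint v∈i v∈j
  ... | inj₁ (u∈i , pu≡v) | inj₂ (v∈j , pv≡u) =
    contradiction (part-≢root v∈j , pv≡u) (child-asym (part-≢root u∈i , pu≡v))
  ... | inj₂ (v∈i , pv≡u) | inj₁ (u∈j , pu≡v) =
    contradiction (part-≢root v∈i , pv≡u) (child-asym (part-≢root u∈j , pu≡v))

  vertex-covered : ∀ v → ∃ λ i → Vs i v ≡ true
  vertex-covered v with v ≟ root
  ... | yes v≡r = let i , t≡r = root-top in i , dec-true (vertex? i v) (inj₂ (trans v≡r (sym t≡r)))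
  ... | no v≢r  = let i , v∈i = covered v≢r in i , dec-true (vertex? i v) (inj₁ v∈i)

  piece-size : ∀ i → size (Vs i) ≤ k
  piece-size i = begin
    size (Vs i)                         ≡⟨ size≡count (vertex? i) ⟩
    count (vertex? i)                   ≤⟨ count-∪ (vertex? i) (part? i) (_≟ top i) id ⟩
    count (part? i) + count (_≟ top i)  ≤⟨ +-monoʳ-≤ _ (count-≤1 (_≟ top i) λ u≡t v≡t → trans u≡t (sym v≡t)) ⟩
    count (part? i) + 1                 ≡⟨ +-comm _ 1 ⟩
    suc (count (part? i))               ≤⟨ small i ⟩
    k                                   ∎
    where open ≤-Reasoning

  decomposition : IsTreeDecomposition E Vs Es × (∀ i → size (Vs i) ≤ k)
  decomposition = (piece-tree , Es⊆E , edge-covered , edge-unique , vertex-covered) , piece-size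

tree-decomposition : (E : ESet n) → IsTree full E → ∀ {k L j} → 1 ≤ L → L + L ≤ k → n ≤ k + j * L →
  Σ (Fin (suc j) → VSet n) λ Vs → Σ (Fin (suc j) → ESet n) λ Es →
    IsTreeDecomposition E Vs Es × (∀ i → size (Vs i) ≤ k)
tree-decomposition {n} E ((E-sym , E-loopless , _) , (r , _) , connected , acyclic) {k} {L} {j}
                   L≥1 L+L≤k n≤ =
  Vs , Es , decomposition
  where
  reach : ∀ v → Walk E r v
  reach v = connected r v refl refl
  open BreadthFirst E-sym r reach
  parent-adjacent : ∀ {v} → v ≢ r → E v (parent v) ≡ true
  parent-adjacent = proj₁ ∘ parent-spec
  open ParentEdges E-sym E-loopless acyclic rooting parent-adjacent distance-adjacent using (parent-edge)
  open RootedTree rooting using (UpClosed; module Decomposing)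
  non-root : UpClosed (_≢ r)
  non-root = (λ r≢r → r≢r refl) , λ {v} _ → toSum (parent v ≟ r)
  |non-root|<n : count (∁? (_≟ r)) < n
  |non-root|<n = subst (count (∁? (_≟ r)) <_) count-U
                   (count-< (∁? (_≟ r)) U? (λ _ → tt) tt λ r≢r → r≢r refl)
  open Pieces E-sym acyclic rooting parent-adjacent parent-edge
    (Decomposing.decompose L≥1 L+L≤k j (∁? (_≟ r)) non-root (<-≤-trans |non-root|<n n≤))

⌊n/2⌋+⌊n/2⌋≤n : ∀ k → ⌊ k /2⌋ + ⌊ k /2⌋ ≤ k
⌊n/2⌋+⌊n/2⌋≤n k = begin
  ⌊ k /2⌋ + ⌊ k /2⌋  ≤⟨ +-monoʳ-≤ ⌊ k /2⌋ (⌊n/2⌋≤⌈n/2⌉ k) ⟩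
  ⌊ k /2⌋ + ⌈ k /2⌉  ≡⟨ ⌊n/2⌋+⌈n/2⌉≡n k ⟩
  k                  ∎
  where open ≤-Reasoning

n≤1+⌊n/2⌋+⌊n/2⌋ : ∀ k → k ≤ suc (⌊ k /2⌋ + ⌊ k /2⌋)
n≤1+⌊n/2⌋+⌊n/2⌋ k = begin
  k                        ≡⟨ ⌊n/2⌋+⌈n/2⌉≡n k ⟨
  ⌊ k /2⌋ + ⌈ k /2⌉        ≤⟨ +-monoʳ-≤ ⌊ k /2⌋ (⌊n/2⌋-mono (n≤1+n (suc k))) ⟩
  ⌊ k /2⌋ + suc ⌊ k /2⌋    ≡⟨ +-suc ⌊ k /2⌋ ⌊ k /2⌋ ⟩
  suc (⌊ k /2⌋ + ⌊ k /2⌋)  ∎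
  where open ≤-Reasoning

4[1+a]∸2≡2+4a : ∀ a → 4 * suc a ∸ 2 ≡ 2 + 4 * a
4[1+a]∸2≡2+4a a = cong (_∸ 2) (*-suc 4 a)

pieces-suffice : ∀ a k → 4 * a ∸ 2 ≤ k → a * k ≤ k + (2 * a ∸ 1) * ⌊ k /2⌋
pieces-suffice zero    k _         = z≤n
pieces-suffice (suc a) k 4[1+a]∸2≤k = begin
  suc a * k                          ≤⟨ +-monoʳ-≤ k (*-monoʳ-≤ a (n≤1+⌊n/2⌋+⌊n/2⌋ k)) ⟩
  k + a * suc (L + L)                ≡⟨ cong (k +_) (*-suc a (L + L)) ⟩
  k + (a + a * (L + L))              ≤⟨ +-monoʳ-≤ k (+-monoˡ-≤ _ a≤L) ⟩
  k + (L + a * (L + L))              ≡⟨ cong (k +_) (regroup a L) ⟩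
  k + (2 * suc a ∸ 1) * L            ∎
  where
  open ≤-Reasoning
  L = ⌊ k /2⌋
  2+4a≤k : 2 + 4 * a ≤ k
  2+4a≤k = subst (_≤ k) (4[1+a]∸2≡2+4a a) 4[1+a]∸2≤k
  a≤L : a ≤ L
  a≤L = begin
    a                ≡⟨ n≡⌊n+n/2⌋ a ⟩
    ⌊ a + a /2⌋      ≤⟨ ⌊n/2⌋-mono (≤-trans (+-monoʳ-≤ a (m≤m+n a _)) (≤-trans (m≤n+m _ 2) 2+4a≤k)) ⟩
    L                ∎
  regroup : ∀ b l → l + b * (l + l) ≡ (b + suc (b + 0)) * l
  regroup = solve-∀

lemma3 : (a k : ℕ) → 1 ≤ a → 4 * a ∸ 2 ≤ k →
    (E : ESet (a * k)) → IsTree full E →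
    Σ (Fin (2 * a) → VSet (a * k)) λ Vs →
    Σ (Fin (2 * a) → ESet (a * k)) λ Es →
    IsTreeDecomposition E Vs Es × (∀ i → size (Vs i) ≤ k)
lemma3 zero    k ()
-- Fin (2 * suc a) is definitionally Fin (suc (2 * suc a ∸ 1)).
lemma3 (suc a) k _ 4a∸2≤k E T =
  tree-decomposition E T (⌊n/2⌋-mono 2≤k) (⌊n/2⌋+⌊n/2⌋≤n k) (pieces-suffice (suc a) k 4a∸2≤k)
  where
  2≤k : 2 ≤ k
  2≤k = ≤-trans (m≤m+n 2 (4 * a)) (subst (_≤ k) (4[1+a]∸2≡2+4a a) 4a∸2≤k)
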